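{- Let $\mathcal{L}$ be a finite trim lattice of length $n$ with left modular labelling $\gamma$ (defined in the context). Then: (a) $\gamma$ is descriptive: every $x\in\mathcal{L}$ is determined by $\mathrm{D}^\gamma(x)$, every $x\in\mathcal{L}$ is determined by $\mathrm{U}^\gamma(x)$, and $\{\mathrm{D}^\gamma(x): x\in\mathcal{L}\}=\{\mathrm{U}^\gamma(x): x\in\mathcal{L}\}$. Hence rowmotion $\mathrm{row}^\gamma:\mathcal{L}\to\mathcal{L}$, sending $x$ to the unique $y\in\mathcal{L}$ with $\mathrm{U}^\gamma(y)=\mathrm{D}^\gamma(x)$, is well defined. (b) Rowmotion can be computed in slow motion: for every linear extension $(l_1,l_2,\dots,l_n)$ of the Galois poset $P(\mathcal{L})$, \[\mathrm{row}^\gamma=\mathrm{flip}^\gamma_{l_n}\circ\cdots\circ\mathrm{flip}^\gamma_{l_2}\circ\mathrm{flip}^\gamma_{l_1},\] i.e. one applies first the flip at $l_1$, then at $l_2$, and so on.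
   Context: All lattices are finite. For a lattice $\mathcal{L}$ with minimum $\hat0$ and maximum $\hat1$, $\mathcal{J}$ denotes the set of join-irreducible elements (elements $x\neq\hat0$ not of the form $y\vee z$ with $y,z<x$) and $\mathcal{M}$ the set of meet-irreducible elements (dually; $\hat1\notin\mathcal{M}$). The length of $\mathcal{L}$ is the largest $r$ for which there is a chain $x_0<x_1<\dots<x_r$. $\mathcal{L}$ is extremal if it has length $n$ and $|\mathcal{J}|=|\mathcal{M}|=n$. An element $x$ is left modular if $(y\vee x)\wedge z=y\vee(x\wedge z)$ for all $y\le z$; $\mathcal{L}$ is left modular if it has a maximal chain consisting of left modular elements; $\mathcal{L}$ is trim if it is both extremal and left modular. For a trim lattice of length $n$, fix a chain $\hat0=x_0\lessdot x_1\lessdot\dots\lessdot x_n=\hat1$ of left modular elements of length $n$. For $i\in[n]=\{1,\dots,n\}$, let $j_i$ be the unique join-irreducible with $j_i\le x_i$, $j_i\not\le x_{i-1}$, and $m_i$ the unique meet-irreducible with $m_i\ge x_{i-1}$, $m_i\not\ge x_i$ (so $x_i=j_1\vee\dots\vee j_i=m_{i+1}\wedge\dots\wedge m_n$). The left modular labelling of a cover relation is $\gamma(y\lessdot z)=\min\{i\in[n]: y\vee(x_i\wedge z)=z\}$ (equivalently, the least $i$ with $y\vee j_i=z$, and also the greatest $i$ with $z\wedge m_i=y$); distinct covers incident to the same element receive distinct labels. Downward labels: $\mathrm{D}^\gamma(y)=\{\gamma(x\lessdot y): x\lessdot y\}$; upward labels: $\mathrm{U}^\gamma(y)=\{\gamma(y\lessdot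 z): y\lessdot z\}$. The Galois graph $G(\mathcal{L})$ is the directed graph on $[n]$ with an arrow $i\to k$ iff $i\ne k$ and $j_i\not\le m_k$ (arrows only occur with $i>k$). The Galois poset $P(\mathcal{L})$ is the partial order on $[n]$ with $k\le i$ iff there is a directed path (possibly of length $0$) from $i$ to $k$ in $G(\mathcal{L})$. For $i\in[n]$, $\mathrm{flip}^\gamma_i:\mathcal{L}\to\mathcal{L}$ sends $y$ to the element $x$ with $x\lessdot y$ and $\gamma(x\lessdot y)=i$ if $i\in\mathrm{D}^\gamma(y)$, to the element $z$ with $y\lessdot z$ and $\gamma(y\lessdot z)=i$ if $i\in\mathrm{U}^\gamma(y)$, and fixes $y$ otherwise. -}

module Defs where

open import Level using (0ℓ)
open import Data.Nat as ℕ using (ℕ; zero; suc)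
open import Data.Fin as Fin using (Fin; inject₁; fromℕ)
open import Data.Product using (Σ; ∃; ∃-syntax; _×_; _,_)
open import Data.Sum using (_⊎_)
open import Relation.Nullary using (¬_)
open import Relation.Binary.Core using (Rel)
open import Relation.Binary.Definitions using (Decidable)
open import Relation.Binary.PropositionalEquality using (_≡_; _≢_)
open import Relation.Binary.Lattice.Structures using (IsBoundedLattice)
open import Relation.Binary.Construct.Closure.ReflexiveTransitive using (Star)
open import Function.Bundles using (_⇔_)
open import Function.Definitions using (Injective; Surjective)

-- A finite lattice: carrier Fin N (any finite set up to renaming),
-- equality is propositional equality, with a decidable partial order.

record FiniteLattice : Set₁ where
  infix  4 _≤_
  infixr 6 _∨_
  infixr 7 _∧_
  field
    N                : ℕ
    _≤_              : Rel (Fin N) 0ℓ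
    _∨_              : Fin N → Fin N → Fin N
    _∧_              : Fin N → Fin N → Fin N
    ⊤                : Fin N
    ⊥                : Fin N
    isBoundedLattice : IsBoundedLattice _≡_ _≤_ _∨_ _∧_ ⊤ ⊥
    _≤?_             : Decidable _≤_

  Carrier : Set
  Carrier = Fin N

module Notions (L : FiniteLattice) where
  open FiniteLattice L

  infix 4 _<_ _⋖_

  _<_ : Carrier → Carrier → Set
  x < y = x ≤ y × x ≢ y

  _⋖_ : Carrier → Carrier → Set
  x ⋖ y = x < y × (∀ z → x < z → ¬ (z < y))

  IsJoinIrreducible : Carrier → Set
  IsJoinIrreducible x = x ≢ ⊥ × (∀ y z → y < x → z < x → y ∨ z ≢ x)

  IsMeetIrreducible : Carrier → Set
  IsMeetIrreducible x = x ≢ ⊤ × (∀ y z → x < y → x < z → y ∧ z ≢ x)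

  IsChain : (r : ℕ) → (Fin (suc r) → Carrier) → Set
  IsChain r c = ∀ (i : Fin r) → c (inject₁ i) < c (Fin.suc i)

  HasLength : ℕ → Set
  HasLength n = (Σ (Fin (suc n) → Carrier) (IsChain n))
              × (∀ r (c : Fin (suc r) → Carrier) → IsChain r c → r ℕ.≤ n)

  HasExactly : ℕ → (Carrier → Set) → Set
  HasExactly n P = Σ (Fin n → Carrier) λ e →
    Injective _≡_ _≡_ e × (∀ i → P (e i)) × (∀ x → P x → ∃[ i ] e i ≡ x)

  IsExtremal : ℕ → Set
  IsExtremal n = HasLength n × HasExactly n IsJoinIrreducible
                             × HasExactly n IsMeetIrreducible

  IsLeftModularElement : Carrier → Set
  IsLeftModularElement x = ∀ y z → y ≤ z → ((y ∨ x) ∧ z) ≡ (y ∨ (x ∧ z))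

  IsLeftModularChain : (n : ℕ) → (Fin (suc n) → Carrier) → Set
  IsLeftModularChain n c =
    c Fin.zero ≡ ⊥ × c (fromℕ n) ≡ ⊤
    × (∀ (i : Fin n) → c (inject₁ i) ⋖ c (Fin.suc i))
    × (∀ i → IsLeftModularElement (c i))

  -- From here on, labels are Fin n; label i : Fin n stands for the
  -- paper's label i+1 ∈ [n]; the paper's x_{i+1} is c (suc i), and
  -- x_i is c (inject₁ i).
  module Labelling (n : ℕ) (c : Fin (suc n) → Carrier) where

    γ : Carrier → Carrier → Fin n → Set
    γ y z i = y ⋖ z × (y ∨ (c (Fin.suc i) ∧ z)) ≡ z
            × (∀ (k : Fin n) → k Fin.< i → (y ∨ (c (Fin.suc k) ∧ z)) ≢ z)

    InD : Carrier → Fin n → Set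
    InD y i = ∃[ x ] γ x y i

    InU : Carrier → Fin n → Set
    InU y i = ∃[ z ] γ y z i

    Row : Carrier → Carrier → Set
    Row x y = ∀ i → InU y i ⇔ InD x i

    Flip : Fin n → Carrier → Carrier → Set
    Flip i y w = γ w y i
               ⊎ (¬ InD y i × γ y w i)
               ⊎ (¬ InD y i × ¬ InU y i × w ≡ y)

    IsJ : Fin n → Carrier → Set
    IsJ i j = IsJoinIrreducible j × j ≤ c (Fin.suc i) × ¬ (j ≤ c (inject₁ i))

    IsM : Fin n → Carrier → Set
    IsM i m = IsMeetIrreducible m × c (inject₁ i) ≤ m × ¬ (c (Fin.suc i) ≤ m)

    GaloisArrow : Fin n → Fin n → Set
    GaloisArrow i k = i ≢ k × ∃[ j ] ∃[ m ] (IsJ i j × IsM k m × ¬ (j ≤ m))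

    _≤P_ : Fin n → Fin n → Set
    k ≤P i = Star GaloisArrow i k

    IsLinearExtension : (Fin n → Fin n) → Set
    IsLinearExtension l = Injective _≡_ _≡_ l × Surjective _≡_ _≡_ l
                        × (∀ a b → l a ≤P l b → a Fin.≤ b)

    IsFlipSequence : (Fin n → Fin n) → Carrier → (Fin (suc n) → Carrier) → Set
    IsFlipSequence l x w = w Fin.zero ≡ x
      × (∀ (k : Fin n) → Flip (l k) (w (inject₁ k)) (w (Fin.suc k)))

-- A cover y ⋖ z has left modular label i exactly when j_i ≤ z, j_i ≰ y,
-- y ≤ m_i and z ≰ m_i, and then z = y ∨ j_i and y = z ∧ m_i. Hence x is
-- the join of the j_i with i ∈ D(x) and the meet of the m_i with i ∈ U(x),
-- so D and U are injective. The labels of D(x), and those of U(x), are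
-- pairwise non-adjacent in the Galois graph, and this makes a flip at i
-- harmless elsewhere: it preserves membership in U of every label not
-- above i, and membership in D of every label not below i, in P(L).
-- Flipping along a linear extension therefore trades the down-labels of x
-- for up-labels one by one, ending at an element y with U(y) = D(x).
-- Rowmotion is then an injection of the finite lattice into itself, hence
-- onto, which gives {D(x)} = {U(x)}.
module Submission where

open import Level using (0ℓ)
open import Data.Nat as ℕ using (ℕ; zero; suc; z≤n; s≤s)
import Data.Nat.Properties as ℕₚ
open import Data.Fin as Fin using (Fin; inject₁; fromℕ; toℕ)
import Data.Fin.Properties as Finₚ
open import Data.Fin.Induction using (spo-wellFounded; <-wellFounded; >-wellFounded; <-weakInduction)
open import Data.Product using (Σ; ∃; ∃-syntax; _×_; _,_; proj₁; proj₂)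
open import Data.Sum using (_⊎_; inj₁; inj₂; [_,_]′)
open import Data.Empty using (⊥-elim)
open import Function using (_∘_; id; flip)
open import Function.Bundles using (_⇔_; mk⇔; module Equivalence)
open import Function.Construct.Composition using (_⇔-∘_)
open import Function.Construct.Symmetry using (⇔-sym)
open import Function.Construct.Identity using (⇔-id)
open import Function.Definitions using (Injective)
open import Induction.WellFounded using (Acc; acc)
open import Relation.Nullary using (¬_; Dec; yes; no; contradiction)
open import Relation.Nullary.Decidable using (_×-dec_; ¬?; _→-dec_)
import Relation.Nullary.Decidable as Dec
open import Relation.Unary using (Pred)
open import Relation.Binary.Core using (Rel)
open import Relation.Binary.Definitions using (Decidable; tri<; tri≈; tri>)
open import Relation.Binary.Structures using (IsPartialOrder; IsStrictPartialOrder)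
open import Relation.Binary.Lattice.Bundles using (Lattice)
open import Relation.Binary.Lattice.Structures using (IsBoundedLattice)
import Relation.Binary.Lattice.Properties.JoinSemilattice as JoinSemilatticeProperties
import Relation.Binary.Lattice.Properties.MeetSemilattice as MeetSemilatticeProperties
open import Relation.Binary.PropositionalEquality using (_≡_; _≢_; refl; sym; trans; cong; subst; subst₂)
open import Relation.Binary.Construct.Closure.ReflexiveTransitive using (Star; ε; _◅_; _◅◅_)
import Relation.Binary.Construct.NonStrictToStrict as ToStrict
import Relation.Binary.Construct.Flip.EqAndOrd as Converse

open import Defs

open Equivalence using (to; from)

module _ {N : ℕ} {_≼_ : Rel (Fin N) 0ℓ}
         (≼-isPartialOrder : IsPartialOrder _≡_ _≼_) (_≼?_ : Decidable _≼_) where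

  open IsPartialOrder ≼-isPartialOrder using () renaming (reflexive to ≼-reflexive; trans to ≼-trans)

  private
    _≺_ : Rel (Fin N) 0ℓ
    _≺_ = ToStrict._<_ _≡_ _≼_

  -- abstract: unfolding the search during type checking is prohibitively expensive
  abstract
    minimal-below : {P : Pred (Fin N) 0ℓ} → (∀ a → Dec (P a)) → ∀ {a} → P a →
                    ∃[ b ] P b × b ≼ a × (∀ {d} → P d → d ≼ b → d ≡ b)
    minimal-below {P} P? {a} Pa = go (spo-wellFounded strict a) Pa
      where
      strict : IsStrictPartialOrder _≡_ _≺_
      strict = ToStrict.<-isStrictPartialOrder _≡_ _≼_ ≼-isPartialOrder

      _≺?_ : Decidable _≺_
      _≺?_ = ToStrict.<-decidable _≡_ _≼_ Finₚ._≟_ _≼?_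

      go : ∀ {a} → Acc _≺_ a → P a → ∃[ b ] P b × b ≼ a × (∀ {d} → P d → d ≼ b → d ≡ b)
      go {a} (acc rec) Pa with Finₚ.any? (λ d → P? d ×-dec d ≺? a)
      ... | yes (d , Pd , d≺a) =
        let b , Pb , b≼d , b-minimal = go (rec d≺a) Pd in b , Pb , ≼-trans b≼d (proj₁ d≺a) , b-minimal
      ... | no nothing-below = a , Pa , ≼-reflexive refl , a-minimal
        where
        a-minimal : ∀ {d} → P d → d ≼ a → d ≡ a
        a-minimal {d} Pd d≼a with d Finₚ.≟ a
        ... | yes d≡a = d≡a
        ... | no d≢a = contradiction (d , Pd , d≼a , d≢a) nothing-below

injective⇒onto : ∀ {m} {f : Fin m → Fin m} → Injective _≡_ _≡_ f → ∀ y → ∃[ x ] f x ≡ y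
injective⇒onto {m} {f} f-injective y with Finₚ.any? (λ x → f x Finₚ.≟ y)
... | yes hit = hit
injective⇒onto {suc m} {f} f-injective y | no miss =
  contradiction (Finₚ.injective⇒≤ punched-injective) (ℕₚ.n≮n m)
  where
  missed : ∀ x → y ≢ f x
  missed x y≡fx = miss (x , sym y≡fx)

  punched : Fin (suc m) → Fin m
  punched x = Fin.punchOut (missed x)

  punched-injective : Injective _≡_ _≡_ punched
  punched-injective {a} {b} eq = f-injective (Finₚ.punchOut-injective (missed a) (missed b) eq)

first-crossing : ∀ {m} {P : Pred (Fin (suc m)) 0ℓ} → (∀ t → Dec (P t)) →
                 ¬ P Fin.zero → P (fromℕ m) →
                 ∃[ k ] P (Fin.suc k) × (∀ j → j Fin.< k → ¬ P (Fin.suc j))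
first-crossing {zero} P? ¬P₀ Pₘ = contradiction Pₘ ¬P₀
first-crossing {suc m} {P} P? ¬P₀ Pₘ with P? (Fin.suc Fin.zero)
... | yes P₁ = Fin.zero , P₁ , λ _ ()
... | no ¬P₁ with first-crossing (P? ∘ Fin.suc) ¬P₁ Pₘ
...   | k , Pk , not-before = Fin.suc k , Pk , earlier
  where
  earlier : ∀ j → j Fin.< Fin.suc k → ¬ P (Fin.suc j)
  earlier Fin.zero _ = ¬P₁
  earlier (Fin.suc j) (s≤s j<k) = not-before j j<k

∃-run : ∀ {A : Set} {m} (R : Fin m → A → A → Set) → (∀ k a → ∃[ b ] R k a b) → ∀ a →
        Σ (Fin (suc m) → A) λ w → w Fin.zero ≡ a × (∀ k → R k (w (inject₁ k)) (w (Fin.suc k)))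
∃-run {m = zero} R step a = (λ _ → a) , refl , λ ()
∃-run {A} {suc m} R step a with step Fin.zero a
... | b , Rab with ∃-run (R ∘ Fin.suc) (step ∘ Fin.suc) b
...   | w , w₀≡b , steps = w′ , refl , steps′
  where
  w′ : Fin (suc (suc m)) → A
  w′ Fin.zero = a
  w′ (Fin.suc j) = w j

  steps′ : ∀ k → R k (w′ (inject₁ k)) (w′ (Fin.suc k))
  steps′ Fin.zero = subst (R Fin.zero a) (sym w₀≡b) Rab
  steps′ (Fin.suc k) = steps k

module FiniteLatticeFacts (L : FiniteLattice) where
  open FiniteLattice L
  open Notions L

  open IsBoundedLattice isBoundedLattice public
    using (isPartialOrder; x≤x∨y; y≤x∨y; ∨-least; x∧y≤x; x∧y≤y; ∧-greatest; maximum; minimum)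
  open IsPartialOrder isPartialOrder public
    using () renaming (refl to ≤-refl; trans to ≤-trans; antisym to ≤-antisym; reflexive to ≤-reflexive)

  private
    lattice : Lattice 0ℓ 0ℓ 0ℓ
    lattice = record { isLattice = IsBoundedLattice.isLattice isBoundedLattice }

    variable
      a w x y z : Carrier

  open JoinSemilatticeProperties (Lattice.joinSemilattice lattice) public
    using (∨-monotonic; ∨-comm) renaming (x≤y⇒x∨y≈y to x≤y⇒x∨y≡y)
  open MeetSemilatticeProperties (Lattice.meetSemilattice lattice) public
    using (∧-monotonic) renaming (y≤x⇒x∧y≈y to y≤x⇒x∧y≡y)

  infix 4 _≰_
  _≰_ : Carrier → Carrier → Set
  x ≰ y = ¬ x ≤ y

  y≤x⇒x∨y≡x : y ≤ x → x ∨ y ≡ x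
  y≤x⇒x∨y≡x y≤x = trans (∨-comm _ _) (x≤y⇒x∨y≡y y≤x)

  ≤∧≱⇒< : x ≤ y → y ≰ x → x < y
  ≤∧≱⇒< x≤y y≰x = x≤y , λ { refl → y≰x ≤-refl }

  ≰⇒x<x∨y : y ≰ x → x < x ∨ y
  ≰⇒x<x∨y y≰x = ≤∧≱⇒< (x≤x∨y _ _) (λ x∨y≤x → y≰x (≤-trans (y≤x∨y _ _) x∨y≤x))

  ≰⇒x∧y<x : x ≰ y → x ∧ y < x
  ≰⇒x∧y<x x≰y = ≤∧≱⇒< (x∧y≤x _ _) (λ x≤x∧y → x≰y (≤-trans x≤x∧y (x∧y≤y _ _)))

  ⋖⇒≤ : x ⋖ y → x ≤ y
  ⋖⇒≤ ((x≤y , _) , _) = x≤y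

  ⋖⇒≢ : x ⋖ y → x ≢ y
  ⋖⇒≢ ((_ , x≢y) , _) = x≢y

  ⋖⇒≱ : x ⋖ y → y ≰ x
  ⋖⇒≱ x⋖y y≤x = ⋖⇒≢ x⋖y (≤-antisym (⋖⇒≤ x⋖y) y≤x)

  ⋖-between : y ⋖ z → y ≤ w → w ≤ z → w ≡ y ⊎ w ≡ z
  ⋖-between {y} {z} {w} (_ , nothing-between) y≤w w≤z with w Finₚ.≟ y | w Finₚ.≟ z
  ... | yes w≡y | _ = inj₁ w≡y
  ... | no _ | yes w≡z = inj₂ w≡z
  ... | no w≢y | no w≢z = ⊥-elim (nothing-between w (y≤w , w≢y ∘ sym) (w≤z , w≢z))

  ⋖-∨∧ : y ⋖ z → ∀ t → y ∨ (t ∧ z) ≡ y ⊎ y ∨ (t ∧ z) ≡ z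
  ⋖-∨∧ y⋖z t = ⋖-between y⋖z (x≤x∨y _ _) (∨-least (⋖⇒≤ y⋖z) (x∧y≤y _ _))

  _<?_ : Decidable _<_
  x <? y = (x ≤? y) ×-dec ¬? (x Finₚ.≟ y)

  _⋖?_ : Decidable _⋖_
  x ⋖? y = (x <? y) ×-dec Finₚ.all? (λ z → (x <? z) →-dec ¬? (z <? y))

  minimal : {P : Pred Carrier 0ℓ} → (∀ a → Dec (P a)) → P a →
            ∃[ b ] P b × b ≤ a × (∀ {d} → P d → d ≤ b → d ≡ b)
  minimal P? = minimal-below isPartialOrder _≤?_ P?

  maximal : {P : Pred Carrier 0ℓ} → (∀ a → Dec (P a)) → P a →
            ∃[ b ] P b × a ≤ b × (∀ {d} → P d → b ≤ d → d ≡ b)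
  maximal P? = minimal-below (Converse.isPartialOrder isPartialOrder) (flip _≤?_) P?

  cover-above : x < z → ∃[ v ] x ⋖ v × v ≤ z
  cover-above {x} {z} x<z with minimal (λ v → (x <? v) ×-dec (v ≤? z)) (x<z , ≤-refl)
  ... | v , (x<v , v≤z) , _ , v-minimal =
    v , (x<v , λ u x<u (u≤v , u≢v) → u≢v (v-minimal (x<u , ≤-trans u≤v v≤z) u≤v)) , v≤z

  cover-below : y < x → ∃[ v ] y ≤ v × v ⋖ x
  cover-below {y} {x} y<x with maximal (λ v → (y ≤? v) ×-dec (v <? x)) (≤-refl , y<x)
  ... | v , (y≤v , v<x) , _ , v-maximal =
    v , y≤v , (v<x , λ u (v≤u , v≢u) u<x → v≢u (sym (v-maximal (≤-trans y≤v v≤u , u<x) v≤u)))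

  chain-monotone : ∀ {m} (f : Fin (suc m) → Carrier) → (∀ i → f (inject₁ i) ≤ f (Fin.suc i)) →
                   ∀ {s t} → s Fin.≤ t → f s ≤ f t
  chain-monotone f step {Fin.zero} {Fin.zero} _ = ≤-refl
  chain-monotone {suc m} f step {Fin.zero} {Fin.suc t} _ =
    ≤-trans (step Fin.zero) (chain-monotone (f ∘ Fin.suc) (step ∘ Fin.suc) {Fin.zero} {t} z≤n)
  chain-monotone {suc m} f step {Fin.suc s} {Fin.suc t} (s≤s s≤t) =
    chain-monotone (f ∘ Fin.suc) (step ∘ Fin.suc) s≤t

  levels-singleton : ∀ {m} {P : Carrier → Set} {Level : Fin m → Carrier → Set} →
                     HasExactly m P → (∀ {i x} → Level i x → P x) →
                     (∀ {i k x} → Level i x → Level k x → i ≡ k) →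
                     (rep : ∀ i → ∃ (Level i)) → ∀ {i x} → Level i x → x ≡ proj₁ (rep i)
  levels-singleton {m} {P} {Level} (e , _ , _ , e-onto) inP disjoint rep {i} {x} x∈i =
    trans x≡r[k] (cong r k≡i)
    where
    r : Fin m → Carrier
    r k = proj₁ (rep k)

    index : Fin m → Fin m
    index k = proj₁ (e-onto (r k) (inP (proj₂ (rep k))))

    e∘index : ∀ k → e (index k) ≡ r k
    e∘index k = proj₂ (e-onto (r k) (inP (proj₂ (rep k))))

    index-injective : Injective _≡_ _≡_ index
    index-injective {a} {b} eq = disjoint (proj₂ (rep a)) (subst (Level b) r[b]≡r[a] (proj₂ (rep b)))
      where
      r[b]≡r[a] : r b ≡ r a
      r[b]≡r[a] = trans (sym (e∘index b)) (trans (cong e (sym eq)) (e∘index a))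

    t = e-onto x (inP x∈i)
    k = proj₁ (injective⇒onto index-injective (proj₁ t))

    x≡r[k] : x ≡ r k
    x≡r[k] = trans (sym (proj₂ t))
                   (trans (cong e (sym (proj₂ (injective⇒onto index-injective (proj₁ t))))) (e∘index k))

    k≡i : k ≡ i
    k≡i = disjoint (subst (Level k) (sym x≡r[k]) (proj₂ (rep k))) x∈i

module LeftModularChainFacts (L : FiniteLattice) (n : ℕ) (c : Fin (suc n) → FiniteLattice.Carrier L)
                             (chain : Notions.IsLeftModularChain L n c) where
  open FiniteLattice L
  open Notions L
  open Labelling n c
  open FiniteLatticeFacts L

  private
    variable
      i k a b : Fin n
      e j m v w x y z : Carrier

  -- the step of the chain carrying label i: the paper's x_i ⋖ x_{i+1}
  lo hi : Fin n → Carrier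
  lo i = c (inject₁ i)
  hi i = c (Fin.suc i)

  c₀≤ : ∀ x → c Fin.zero ≤ x
  c₀≤ x = subst (_≤ x) (sym (proj₁ chain)) (minimum x)

  ≤cₙ : ∀ x → x ≤ c (fromℕ n)
  ≤cₙ x = subst (x ≤_) (sym (proj₁ (proj₂ chain))) (maximum x)

  lo⋖hi : lo i ⋖ hi i
  lo⋖hi = proj₁ (proj₂ (proj₂ chain)) _

  c-leftModular : ∀ t → IsLeftModularElement (c t)
  c-leftModular = proj₂ (proj₂ (proj₂ chain))

  c-monotone : ∀ {s t} → s Fin.≤ t → c s ≤ c t
  c-monotone = chain-monotone c (λ i → ⋖⇒≤ lo⋖hi)

  hi≤lo : i Fin.< k → hi i ≤ lo k
  hi≤lo {k = k} i<k = c-monotone (subst (ℕ._≤_ _) (sym (Finₚ.toℕ-inject₁ k)) i<k)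

  lo-monotone : i Fin.≤ k → lo i ≤ lo k
  lo-monotone {i} {k} i≤k =
    c-monotone (subst₂ ℕ._≤_ (sym (Finₚ.toℕ-inject₁ i)) (sym (Finₚ.toℕ-inject₁ k)) i≤k)

  hi-monotone : i Fin.≤ k → hi i ≤ hi k
  hi-monotone i≤k = c-monotone (s≤s i≤k)

  hi≰lo : hi i ≰ lo i
  hi≰lo = ⋖⇒≱ lo⋖hi

  γ-exists : y ⋖ z → ∃[ i ] γ y z i
  γ-exists {y} {z} y⋖z with first-crossing (λ t → (y ∨ (c t ∧ z)) Finₚ.≟ z) at-zero at-top
    where
    at-zero : y ∨ (c Fin.zero ∧ z) ≢ z
    at-zero eq = ⋖⇒≢ y⋖z (trans (sym (y≤x⇒x∨y≡x (≤-trans (x∧y≤x _ _) (c₀≤ y)))) eq)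

    at-top : y ∨ (c (fromℕ n) ∧ z) ≡ z
    at-top = trans (cong (y ∨_) (y≤x⇒x∧y≡y (≤cₙ z))) (x≤y⇒x∨y≡y (⋖⇒≤ y⋖z))
  ... | i , reaches , not-before = i , y⋖z , reaches , not-before

  γ-cover-above : x < z → ∃[ v ] ∃[ b ] γ x v b × v ≤ z
  γ-cover-above x<z =
    let v , x⋖v , v≤z = cover-above x<z
        b , g = γ-exists x⋖v
    in v , b , g , v≤z

  γ-cover-below : y < x → ∃[ v ] ∃[ b ] y ≤ v × γ v x b
  γ-cover-below y<x =
    let v , y≤v , v⋖x = cover-below y<x
        b , g = γ-exists v⋖x
    in v , b , y≤v , g

  γ-unique : γ y z i → γ y z k → i ≡ k
  γ-unique {i = i} {k = k} (_ , at-i , before-i) (_ , at-k , before-k) with Finₚ.<-cmp i k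
  ... | tri< i<k _ _ = contradiction at-i (before-k i i<k)
  ... | tri≈ _ i≡k _ = i≡k
  ... | tri> _ _ k<i = contradiction at-k (before-i k k<i)

  γ⇒⋖ : γ y z i → y ⋖ z
  γ⇒⋖ = proj₁

  γ⇒y∨hi∧z≡z : γ y z i → y ∨ (hi i ∧ z) ≡ z
  γ⇒y∨hi∧z≡z = proj₁ ∘ proj₂

  γ⇒lo∧z≤y : γ y z i → lo i ∧ z ≤ y
  γ⇒lo∧z≤y {y} {i = Fin.zero} _ = ≤-trans (x∧y≤x _ _) (c₀≤ y)
  γ⇒lo∧z≤y {i = Fin.suc i} (y⋖z , _ , before) with ⋖-∨∧ y⋖z (lo (Fin.suc i))
  ... | inj₁ eq = subst (_ ≤_) eq (y≤x∨y _ _)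
  ... | inj₂ eq = contradiction eq (before (inject₁ i) (Finₚ.≤̄⇒inject₁< Finₚ.≤-refl))

  γ⇒[y∨lo]∧z≡y : γ y z i → (y ∨ lo i) ∧ z ≡ y
  γ⇒[y∨lo]∧z≡y {y} {z} g =
    trans (c-leftModular _ y z (⋖⇒≤ (γ⇒⋖ g))) (y≤x⇒x∨y≡x (γ⇒lo∧z≤y g))

  γ⇒z≤y∨hi : γ y z i → z ≤ y ∨ hi i
  γ⇒z≤y∨hi {y} {z} g = ≤-trans (≤-reflexive z≡[y∨hi]∧z) (x∧y≤x _ _)
    where
    z≡[y∨hi]∧z = sym (trans (c-leftModular _ y z (⋖⇒≤ (γ⇒⋖ g))) (γ⇒y∨hi∧z≡z g))

  γ⇒z≰y∨lo : γ y z i → z ≰ y ∨ lo i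
  γ⇒z≰y∨lo g z≤ = ⋖⇒≱ (γ⇒⋖ g) (subst (_ ≤_) (γ⇒[y∨lo]∧z≡y g) (∧-greatest z≤ ≤-refl))

  γ⇒hi∧z≰y : γ y z i → hi i ∧ z ≰ y
  γ⇒hi∧z≰y g ≤y = ⋖⇒≢ (γ⇒⋖ g) (trans (sym (y≤x⇒x∨y≡x ≤y)) (γ⇒y∨hi∧z≡z g))

  γ-below-lo⇒< : γ w v b → v ≤ w ∨ lo a → b Fin.< a
  γ-below-lo⇒< {b = b} {a = a} g v≤ with b Finₚ.<? a
  ... | yes b<a = b<a
  ... | no b≮a =
    contradiction (≤-trans v≤ (∨-monotonic ≤-refl (lo-monotone (ℕₚ.≮⇒≥ b≮a)))) (γ⇒z≰y∨lo g)

  γ-above-hi⇒< : γ v x b → hi a ∧ x ≤ v → a Fin.< b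
  γ-above-hi⇒< {b = b} {a = a} g ≤v with a Finₚ.<? b
  ... | yes a<b = a<b
  ... | no a≮b =
    contradiction (≤-trans (∧-monotonic (hi-monotone (ℕₚ.≮⇒≥ a≮b)) ≤-refl) ≤v) (γ⇒hi∧z≰y g)

  IsJ-below : e ≤ hi i → e ≰ lo i → ∃[ j ] IsJ i j × j ≤ e
  IsJ-below {e} {i} e≤hi e≰lo with minimal (λ v → (v ≤? e) ×-dec ¬? (v ≤? lo i)) (≤-refl , e≰lo)
  ... | j , (j≤e , j≰lo) , _ , j-minimal = j , ((j≢⊥ , irreducible) , ≤-trans j≤e e≤hi , j≰lo) , j≤e
    where
    j≢⊥ : j ≢ ⊥
    j≢⊥ refl = j≰lo (minimum _)

    below-j≤lo : ∀ {y} → y < j → y ≤ lo i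
    below-j≤lo {y} (y≤j , y≢j) with y ≤? lo i
    ... | yes y≤lo = y≤lo
    ... | no y≰lo = contradiction (j-minimal (≤-trans y≤j j≤e , y≰lo) y≤j) y≢j

    irreducible : ∀ y z → y < j → z < j → y ∨ z ≢ j
    irreducible y z y<j z<j y∨z≡j =
      j≰lo (subst (_≤ lo i) y∨z≡j (∨-least (below-j≤lo y<j) (below-j≤lo z<j)))

  IsM-above : lo i ≤ e → hi i ≰ e → ∃[ m ] IsM i m × e ≤ m
  IsM-above {i} {e} lo≤e hi≰e with maximal (λ v → (e ≤? v) ×-dec ¬? (hi i ≤? v)) (≤-refl , hi≰e)
  ... | m , (e≤m , hi≰m) , _ , m-maximal = m , ((m≢⊤ , irreducible) , ≤-trans lo≤e e≤m , hi≰m) , e≤m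
    where
    m≢⊤ : m ≢ ⊤
    m≢⊤ refl = hi≰m (maximum _)

    hi≤above-m : ∀ {y} → m < y → hi i ≤ y
    hi≤above-m {y} (m≤y , m≢y) with hi i ≤? y
    ... | yes hi≤y = hi≤y
    ... | no hi≰y = contradiction (sym (m-maximal (≤-trans e≤m m≤y , hi≰y) m≤y)) m≢y

    irreducible : ∀ y z → m < y → m < z → y ∧ z ≢ m
    irreducible y z m<y m<z y∧z≡m =
      hi≰m (subst (hi i ≤_) y∧z≡m (∧-greatest (hi≤above-m m<y) (hi≤above-m m<z)))

  IsJ-unique-level : IsJ i j → IsJ k j → i ≡ k
  IsJ-unique-level {i} {k = k} (_ , j≤hiᵢ , j≰loᵢ) (_ , j≤hiₖ , j≰loₖ) with Finₚ.<-cmp i k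
  ... | tri< i<k _ _ = contradiction (≤-trans j≤hiᵢ (hi≤lo i<k)) j≰loₖ
  ... | tri≈ _ i≡k _ = i≡k
  ... | tri> _ _ k<i = contradiction (≤-trans j≤hiₖ (hi≤lo k<i)) j≰loᵢ

  IsM-unique-level : IsM i m → IsM k m → i ≡ k
  IsM-unique-level {i} {k = k} (_ , loᵢ≤m , hiᵢ≰m) (_ , loₖ≤m , hiₖ≰m) with Finₚ.<-cmp i k
  ... | tri< i<k _ _ = contradiction (≤-trans (hi≤lo i<k) loₖ≤m) hiᵢ≰m
  ... | tri≈ _ i≡k _ = i≡k
  ... | tri> _ _ k<i = contradiction (≤-trans (hi≤lo k<i) loᵢ≤m) hiₖ≰m

  GaloisArrow⇒> : GaloisArrow i k → k Fin.< i
  GaloisArrow⇒> {i} {k} (i≢k , j , m , (_ , j≤hi , _) , (_ , lo≤m , _) , j≰m) with Finₚ.<-cmp i k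
  ... | tri< i<k _ _ = contradiction (≤-trans j≤hi (≤-trans (hi≤lo i<k) lo≤m)) j≰m
  ... | tri≈ _ i≡k _ = contradiction i≡k i≢k
  ... | tri> _ _ k<i = k<i

  ≤P⇒≤ : k ≤P i → k Fin.≤ i
  ≤P⇒≤ ε = Finₚ.≤-refl
  ≤P⇒≤ (arrow ◅ path) = Finₚ.≤-trans (≤P⇒≤ path) (ℕₚ.<⇒≤ (GaloisArrow⇒> arrow))

module TrimFacts (L : FiniteLattice) (n : ℕ) (c : Fin (suc n) → FiniteLattice.Carrier L)
                 (extremal : Notions.IsExtremal L n) (chain : Notions.IsLeftModularChain L n c) where
  open FiniteLattice L
  open Notions L
  open Labelling n c
  open FiniteLatticeFacts L
  open LeftModularChainFacts L n c chain

  private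
    variable
      i k a : Fin n
      e u w x y z : Carrier

  abstract
    IsJ-exists : ∀ i → ∃ (IsJ i)
    IsJ-exists i = let j , isJ , _ = IsJ-below ≤-refl (hi≰lo {i}) in j , isJ

    IsM-exists : ∀ i → ∃ (IsM i)
    IsM-exists i = let m , isM , _ = IsM-above ≤-refl (hi≰lo {i}) in m , isM

  J M : Fin n → Carrier
  J i = proj₁ (IsJ-exists i)
  M i = proj₁ (IsM-exists i)

  IsJ⇒≡J : ∀ {j} → IsJ i j → j ≡ J i
  IsJ⇒≡J = levels-singleton (proj₁ (proj₂ extremal)) proj₁ IsJ-unique-level IsJ-exists

  IsM⇒≡M : ∀ {m} → IsM i m → m ≡ M i
  IsM⇒≡M = levels-singleton (proj₂ (proj₂ extremal)) proj₁ IsM-unique-level IsM-exists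

  J≤hi : J i ≤ hi i
  J≤hi {i} = proj₁ (proj₂ (proj₂ (IsJ-exists i)))

  J≰lo : J i ≰ lo i
  J≰lo {i} = proj₂ (proj₂ (proj₂ (IsJ-exists i)))

  lo≤M : lo i ≤ M i
  lo≤M {i} = proj₁ (proj₂ (proj₂ (IsM-exists i)))

  hi≰M : hi i ≰ M i
  hi≰M {i} = proj₂ (proj₂ (proj₂ (IsM-exists i)))

  J-least : e ≤ hi i → e ≰ lo i → J i ≤ e
  J-least e≤hi e≰lo = let _ , isJ , j≤e = IsJ-below e≤hi e≰lo in subst (_≤ _) (IsJ⇒≡J isJ) j≤e

  M-greatest : lo i ≤ e → hi i ≰ e → e ≤ M i
  M-greatest lo≤e hi≰e = let _ , isM , e≤m = IsM-above lo≤e hi≰e in subst (_ ≤_) (IsM⇒≡M isM) e≤m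

  lo∨J≡hi : lo i ∨ J i ≡ hi i
  lo∨J≡hi {i} with ⋖-between lo⋖hi (x≤x∨y (lo i) (J i)) (∨-least (⋖⇒≤ lo⋖hi) J≤hi)
  ... | inj₁ ≡lo = contradiction (subst (J i ≤_) ≡lo (y≤x∨y _ _)) J≰lo
  ... | inj₂ ≡hi = ≡hi

  J≰M : J i ≰ M i
  J≰M {i} J≤M = hi≰M (subst (_≤ M i) lo∨J≡hi (∨-least lo≤M J≤M))

  J≤M : i Fin.< k → J i ≤ M k
  J≤M i<k = ≤-trans J≤hi (≤-trans (hi≤lo i<k) lo≤M)

  -- Covers and their labels

  γ⇒J≤z : γ y z i → J i ≤ z
  γ⇒J≤z g = ≤-trans (J-least (x∧y≤x _ _) hi∧z≰lo) (x∧y≤y _ _)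
    where
    hi∧z≰lo : _ ≰ _
    hi∧z≰lo ≤lo = γ⇒hi∧z≰y g (≤-trans (∧-greatest ≤lo (x∧y≤y _ _)) (γ⇒lo∧z≤y g))

  γ⇒J≰y : γ y z i → J i ≰ y
  γ⇒J≰y {y} {i = i} g J≤y = γ⇒z≰y∨lo g (≤-trans (γ⇒z≤y∨hi g) hi-absorbed)
    where
    hi-absorbed : y ∨ hi i ≤ y ∨ lo i
    hi-absorbed = ∨-least (x≤x∨y _ _)
      (subst (_≤ y ∨ lo i) lo∨J≡hi (∨-least (y≤x∨y _ _) (≤-trans J≤y (x≤x∨y _ _))))

  γ⇒y≤M : γ y z i → y ≤ M i
  γ⇒y≤M g = ≤-trans (x≤x∨y _ _) (M-greatest (y≤x∨y _ _) hi≰y∨lo)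
    where
    hi≰y∨lo : _ ≰ _
    hi≰y∨lo hi≤ = γ⇒z≰y∨lo g (≤-trans (γ⇒z≤y∨hi g) (∨-least (x≤x∨y _ _) hi≤))

  γ⇒z≰M : γ y z i → z ≰ M i
  γ⇒z≰M g z≤M = J≰M (≤-trans (γ⇒J≤z g) z≤M)

  γ⇒z≡y∨J : γ y z i → z ≡ y ∨ J i
  γ⇒z≡y∨J {y} {i = i} g =
    [ (λ ≡y → contradiction (subst (J i ≤_) ≡y (y≤x∨y _ _)) (γ⇒J≰y g)) , sym ]′
    (⋖-between (γ⇒⋖ g) (x≤x∨y y (J i)) (∨-least (⋖⇒≤ (γ⇒⋖ g)) (γ⇒J≤z g)))

  γ⇒y≡z∧M : γ y z i → y ≡ z ∧ M i
  γ⇒y≡z∧M {z = z} {i} g =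
    [ sym , (λ ≡z → contradiction (subst (_≤ M i) ≡z (x∧y≤y _ _)) (γ⇒z≰M g)) ]′
    (⋖-between (γ⇒⋖ g) (∧-greatest (⋖⇒≤ (γ⇒⋖ g)) (γ⇒y≤M g)) (x∧y≤x z (M i)))

  γ⇒z≤ : γ y z i → y ≤ u → J i ≤ u → z ≤ u
  γ⇒z≤ g y≤u J≤u = subst (_≤ _) (sym (γ⇒z≡y∨J g)) (∨-least y≤u J≤u)

  γ⇒≤y : γ y z i → u ≤ z → u ≤ M i → u ≤ y
  γ⇒≤y g u≤z u≤M = subst (_ ≤_) (sym (γ⇒y≡z∧M g)) (∧-greatest u≤z u≤M)

  γ-intro : y ⋖ z → J k ≤ z → J k ≰ y → y ≤ M k → z ≰ M k → γ y z k
  γ-intro {k = k} y⋖z J≤z J≰y y≤M z≰M with γ-exists y⋖z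
  ... | i , g with Finₚ.<-cmp i k
  ...   | tri< i<k _ _ = contradiction (γ⇒z≤ g y≤M (J≤M i<k)) z≰M
  ...   | tri≈ _ i≡k _ = subst (γ _ _) i≡k g
  ...   | tri> _ _ k<i = contradiction (γ⇒≤y g J≤z (J≤M k<i)) J≰y

  InD⇔ : InD x i ⇔ (J i ≤ x × x ∧ M i ⋖ x)
  InD⇔ {x} {i} = mk⇔
    (λ (y , g) → γ⇒J≤z g , subst (_⋖ x) (γ⇒y≡z∧M g) (γ⇒⋖ g))
    (λ (J≤x , ⋖x) → x ∧ M i , γ-intro ⋖x J≤x (λ J≤ → J≰M (≤-trans J≤ (x∧y≤y _ _)))
                                       (x∧y≤y _ _) (λ x≤M → J≰M (≤-trans J≤x x≤M)))

  InU⇔ : InU y i ⇔ (y ≤ M i × y ⋖ y ∨ J i)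
  InU⇔ {y} {i} = mk⇔
    (λ (z , g) → γ⇒y≤M g , subst (y ⋖_) (γ⇒z≡y∨J g) (γ⇒⋖ g))
    (λ (y≤M , y⋖) → y ∨ J i , γ-intro y⋖ (y≤x∨y _ _) (λ J≤y → J≰M (≤-trans J≤y y≤M))
                                       y≤M (λ ≤M → J≰M (≤-trans (y≤x∨y _ _) ≤M)))

  abstract
    InD? : ∀ x i → Dec (InD x i)
    InD? x i = Dec.map (⇔-sym InD⇔) ((J i ≤? x) ×-dec ((x ∧ M i) ⋖? x))

    InU? : ∀ y i → Dec (InU y i)
    InU? y i = Dec.map (⇔-sym InU⇔) ((y ≤? M i) ×-dec (y ⋖? (y ∨ J i)))

  InD⇒J≤ : InD x i → J i ≤ x
  InD⇒J≤ (_ , g) = γ⇒J≤z g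

  InU⇒≤M : InU y i → y ≤ M i
  InU⇒≤M (_ , g) = γ⇒y≤M g

  InD⇒¬InU : InD x i → ¬ InU x i
  InD⇒¬InU d u = J≰M (≤-trans (InD⇒J≤ d) (InU⇒≤M u))

  ≤-from-D : (∀ i → InD x i → J i ≤ w) → x ≤ w
  ≤-from-D {x} {w} J≤w with x ≤? w
  ... | yes x≤w = x≤w
  ... | no x≰w with γ-cover-below (≰⇒x∧y<x x≰w)
  ...   | v , i , x∧w≤v , g =
    contradiction (≤-trans (∧-greatest (γ⇒J≤z g) (J≤w i (v , g))) x∧w≤v) (γ⇒J≰y g)

  ≥-from-U : (∀ i → InU x i → w ≤ M i) → w ≤ x
  ≥-from-U {x} {w} ≤M with w ≤? x
  ... | yes w≤x = w≤x
  ... | no w≰x with γ-cover-above (≰⇒x<x∨y w≰x)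
  ...   | v , i , g , v≤x∨w =
    contradiction (≤-trans v≤x∨w (∨-least (γ⇒y≤M g) (≤M i (v , g)))) (γ⇒z≰M g)

  D-injective : ∀ x y → (∀ i → InD x i ⇔ InD y i) → x ≡ y
  D-injective x y D⇔D = ≤-antisym (≤-from-D (λ i → InD⇒J≤ ∘ to (D⇔D i)))
                                  (≤-from-D (λ i → InD⇒J≤ ∘ from (D⇔D i)))

  U-injective : ∀ x y → (∀ i → InU x i ⇔ InU y i) → x ≡ y
  U-injective x y U⇔U = ≤-antisym (≥-from-U (λ i → InU⇒≤M ∘ from (U⇔U i)))
                                  (≥-from-U (λ i → InU⇒≤M ∘ to (U⇔U i)))

  InU-intro : w ≤ M k → (∀ a → a Fin.< k → InU w a → J k ≤ M a) → InU w k
  InU-intro {w} {k} w≤M independent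
    with γ-cover-above (≰⇒x<x∨y (λ J≤w → J≰M (≤-trans J≤w w≤M)))
  ... | v , b , g , v≤w∨J with Finₚ.<-cmp b k
  ... | tri< b<k _ _ =
    contradiction (≤-trans v≤w∨J (∨-least (γ⇒y≤M g) (independent b b<k (v , g)))) (γ⇒z≰M g)
  ... | tri≈ _ b≡k _ = v , subst (γ w v) b≡k g
  ... | tri> _ _ k<b =
    contradiction (≤-trans v≤w∨J (∨-monotonic ≤-refl (≤-trans J≤hi (hi≤lo k<b)))) (γ⇒z≰y∨lo g)

  InD-intro : J k ≤ x → (∀ b → k Fin.< b → InD x b → J b ≤ M k) → InD x k
  InD-intro {k} {x} J≤x independent
    with γ-cover-below (≰⇒x∧y<x (λ x≤M → J≰M (≤-trans J≤x x≤M)))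
  ... | v , b , x∧M≤v , g with Finₚ.<-cmp b k
  ... | tri< b<k _ _ = contradiction (≤-trans hi∧x≤x∧M x∧M≤v) (γ⇒hi∧z≰y g)
    where
    hi∧x≤x∧M : hi b ∧ x ≤ x ∧ M k
    hi∧x≤x∧M = ∧-greatest (x∧y≤y _ _) (≤-trans (x∧y≤x _ _) (≤-trans (hi≤lo b<k) lo≤M))
  ... | tri≈ _ b≡k _ = v , subst (γ v x) b≡k g
  ... | tri> _ _ k<b =
    contradiction (≤-trans (∧-greatest (γ⇒J≤z g) (independent b k<b (v , g))) x∧M≤v) (γ⇒J≰y g)

  -- Independence of the labels in D(x) and in U(x)

  -- If J k ≰ M a, then r = lo a ∧ (zₖ ∨ zₐ) is not below w, and a cover of w inside w ∨ r
  -- carries a smaller label than a.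
  lower-U-label : ∀ {zₐ zₖ} → a Fin.< k → γ w zₐ a → γ w zₖ k → J k ≰ M a →
                  ∃[ b ] ∃[ v ] b Fin.< a × γ w v b × v ≤ zₖ ∨ zₐ
  lower-U-label {a} {k} {w} {zₐ} {zₖ} a<k gₐ gₖ J≰M with hi a ≤? (zₖ ∨ lo a)
  ... | no hi≰ =
    contradiction (≤-trans (γ⇒J≤z gₖ) (≤-trans (x≤x∨y _ _) (M-greatest (y≤x∨y _ _) hi≰))) J≰M
  ... | yes hi≤ = let v , b , g , v≤w∨r = γ-cover-above (≰⇒x<x∨y r≰w) in
    b , v , γ-below-lo⇒< g (≤-trans v≤w∨r w∨r≤w∨lo) , g , ≤-trans v≤w∨r w∨r≤zₖ∨zₐ
    where
    r : Carrier
    r = lo a ∧ (zₖ ∨ zₐ)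

    zₖ∨r≡zₖ∨zₐ : zₖ ∨ r ≡ zₖ ∨ zₐ
    zₖ∨r≡zₖ∨zₐ = trans (sym (c-leftModular _ zₖ _ (x≤x∨y _ _))) (y≤x⇒x∧y≡y zₖ∨zₐ≤zₖ∨lo)
      where
      zₖ∨zₐ≤zₖ∨lo : zₖ ∨ zₐ ≤ zₖ ∨ lo a
      zₖ∨zₐ≤zₖ∨lo = ∨-least (x≤x∨y _ _)
        (≤-trans (γ⇒z≤y∨hi gₐ) (∨-least (≤-trans (⋖⇒≤ (γ⇒⋖ gₖ)) (x≤x∨y _ _)) hi≤))

    r≤w⇒zₐ≤zₖ : r ≤ w → zₐ ≤ zₖ
    r≤w⇒zₐ≤zₖ r≤w = ≤-trans (y≤x∨y zₖ zₐ)
      (subst (_≤ zₖ) zₖ∨r≡zₖ∨zₐ (∨-least ≤-refl (≤-trans r≤w (⋖⇒≤ (γ⇒⋖ gₖ)))))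

    r≰w : r ≰ w
    r≰w r≤w with ⋖-between (γ⇒⋖ gₖ) (⋖⇒≤ (γ⇒⋖ gₐ)) (r≤w⇒zₐ≤zₖ r≤w)
    ... | inj₁ zₐ≡w = ⋖⇒≢ (γ⇒⋖ gₐ) (sym zₐ≡w)
    ... | inj₂ zₐ≡zₖ = Finₚ.<⇒≢ a<k (γ-unique gₐ (subst (λ u → γ w u k) (sym zₐ≡zₖ) gₖ))

    w∨r≤w∨lo : w ∨ r ≤ w ∨ lo a
    w∨r≤w∨lo = ∨-monotonic ≤-refl (x∧y≤x _ _)

    w∨r≤zₖ∨zₐ : w ∨ r ≤ zₖ ∨ zₐ
    w∨r≤zₖ∨zₐ = ∨-least (≤-trans (⋖⇒≤ (γ⇒⋖ gₖ)) (x≤x∨y _ _)) (x∧y≤y _ _)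

  U-independent : a Fin.< k → InU w a → InU w k → J k ≤ M a
  U-independent {a} = go (<-wellFounded a)
    where
    go : ∀ {a k w} → Acc Fin._<_ a → a Fin.< k → InU w a → InU w k → J k ≤ M a
    go {a} {k} (acc rec) a<k (zₐ , gₐ) (zₖ , gₖ) with J k ≤? M a
    ... | yes J≤M = J≤M
    ... | no J≰M with lower-U-label a<k gₐ gₖ J≰M
    ...   | b , v , b<a , g , v≤zₖ∨zₐ = contradiction (≤-trans v≤zₖ∨zₐ zₖ∨zₐ≤M) (γ⇒z≰M g)
      where
      zₖ∨zₐ≤M : zₖ ∨ zₐ ≤ M b
      zₖ∨zₐ≤M = ∨-least
        (γ⇒z≤ gₖ (γ⇒y≤M g) (go (rec b<a) (Finₚ.<-trans b<a a<k) (v , g) (zₖ , gₖ)))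
        (γ⇒z≤ gₐ (γ⇒y≤M g) (go (rec b<a) b<a (v , g) (zₐ , gₐ)))

  -- Dually, with r = (yₖ ∧ yᵢ) ∨ hi i.
  upper-D-label : ∀ {yₖ yᵢ} → k Fin.< i → γ yₖ x k → γ yᵢ x i → J i ≰ M k →
                  ∃[ b ] ∃[ v ] i Fin.< b × γ v x b × yₖ ∧ yᵢ ≤ v
  upper-D-label {k} {i} {x} {yₖ} {yᵢ} k<i gₖ gᵢ J≰M with (hi i ∧ yₖ) ≤? lo i
  ... | no ≰lo =
    contradiction (≤-trans (J-least (x∧y≤x _ _) ≰lo) (≤-trans (x∧y≤y _ _) (γ⇒y≤M gₖ))) J≰M
  ... | yes ≤lo = let v , b , x∧r≤v , g = γ-cover-below (≰⇒x∧y<x x≰r) in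
    b , v , γ-above-hi⇒< g (≤-trans hi∧x≤x∧r x∧r≤v) , g , ≤-trans yₖ∧yᵢ≤x∧r x∧r≤v
    where
    r : Carrier
    r = (yₖ ∧ yᵢ) ∨ hi i

    r∧yₖ≡yₖ∧yᵢ : r ∧ yₖ ≡ yₖ ∧ yᵢ
    r∧yₖ≡yₖ∧yᵢ = trans (c-leftModular _ _ yₖ (x∧y≤x _ _)) (y≤x⇒x∨y≡x hi∧yₖ≤yₖ∧yᵢ)
      where
      hi∧yₖ≤yₖ∧yᵢ : hi i ∧ yₖ ≤ yₖ ∧ yᵢ
      hi∧yₖ≤yₖ∧yᵢ = ∧-greatest (x∧y≤y _ _)
        (≤-trans (∧-greatest ≤lo (≤-trans (x∧y≤y _ _) (⋖⇒≤ (γ⇒⋖ gₖ)))) (γ⇒lo∧z≤y gᵢ))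

    x≤r⇒yₖ≤yᵢ : x ≤ r → yₖ ≤ yᵢ
    x≤r⇒yₖ≤yᵢ x≤r = ≤-trans (subst (yₖ ≤_) r∧yₖ≡yₖ∧yᵢ yₖ≤r∧yₖ) (x∧y≤y _ _)
      where
      yₖ≤r∧yₖ : yₖ ≤ r ∧ yₖ
      yₖ≤r∧yₖ = ∧-greatest (≤-trans (⋖⇒≤ (γ⇒⋖ gₖ)) x≤r) ≤-refl

    x≰r : x ≰ r
    x≰r x≤r with ⋖-between (γ⇒⋖ gₖ) (x≤r⇒yₖ≤yᵢ x≤r) (⋖⇒≤ (γ⇒⋖ gᵢ))
    ... | inj₁ yᵢ≡yₖ = Finₚ.<⇒≢ k<i (γ-unique gₖ (subst (λ u → γ u x i) yᵢ≡yₖ gᵢ))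
    ... | inj₂ yᵢ≡x = ⋖⇒≢ (γ⇒⋖ gᵢ) yᵢ≡x

    hi∧x≤x∧r : hi i ∧ x ≤ x ∧ r
    hi∧x≤x∧r = ∧-greatest (x∧y≤y _ _) (≤-trans (x∧y≤x _ _) (y≤x∨y _ _))

    yₖ∧yᵢ≤x∧r : yₖ ∧ yᵢ ≤ x ∧ r
    yₖ∧yᵢ≤x∧r = ∧-greatest (≤-trans (x∧y≤x _ _) (⋖⇒≤ (γ⇒⋖ gₖ))) (x≤x∨y _ _)

  D-independent : k Fin.< i → InD x k → InD x i → J i ≤ M k
  D-independent {i = i} = go (>-wellFounded i)
    where
    go : ∀ {k i x} → Acc Fin._>_ i → k Fin.< i → InD x k → InD x i → J i ≤ M k
    go {k} {i} (acc rec) k<i (yₖ , gₖ) (yᵢ , gᵢ) with J i ≤? M k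
    ... | yes J≤M = J≤M
    ... | no J≰M with upper-D-label k<i gₖ gᵢ J≰M
    ...   | b , v , i<b , g , yₖ∧yᵢ≤v = contradiction (≤-trans J≤yₖ∧yᵢ yₖ∧yᵢ≤v) (γ⇒J≰y g)
      where
      J≤yₖ∧yᵢ : J b ≤ yₖ ∧ yᵢ
      J≤yₖ∧yᵢ = ∧-greatest
        (γ⇒≤y gₖ (γ⇒J≤z g) (go (rec i<b) (Finₚ.<-trans k<i i<b) (yₖ , gₖ) (v , g)))
        (γ⇒≤y gᵢ (γ⇒J≤z g) (go (rec i<b) i<b (yᵢ , gᵢ) (v , g)))

  J≰M⇒GaloisArrow : i ≢ k → J i ≰ M k → GaloisArrow i k
  J≰M⇒GaloisArrow {i} {k} i≢k J≰M =
    i≢k , J i , M k , proj₂ (IsJ-exists i) , proj₂ (IsM-exists k) , J≰M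

  InU-transfer : InU x k → y ≤ M k → (∀ {a} → a Fin.< k → J k ≰ M a → InU y a → InU x a) → InU y k
  InU-transfer {x} {k} uₖ y≤M transport = InU-intro y≤M independent
    where
    independent : ∀ a → a Fin.< k → InU _ a → J k ≤ M a
    independent a a<k u with J k ≤? M a
    ... | yes J≤M = J≤M
    ... | no J≰M = contradiction (U-independent a<k (transport a<k J≰M u) uₖ) J≰M

  InD-transfer : InD x k → J k ≤ y → (∀ {b} → k Fin.< b → J b ≰ M k → InD y b → InD x b) → InD y k
  InD-transfer {x} {k} dₖ J≤y transport = InD-intro J≤y independent
    where
    independent : ∀ b → k Fin.< b → InD _ b → J b ≤ M k
    independent b k<b d with J b ≤? M k
    ... | yes J≤M = J≤M
    ... | no J≰M = contradiction (D-independent k<b dₖ (transport k<b J≰M d)) J≰M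

  InU-stable : ∀ {w w′ i} → γ w w′ i → ∀ {k} → k ≢ i → ¬ i ≤P k → InU w k ⇔ InU w′ k
  InU-stable {w} {w′} {i} g {k} = go (<-wellFounded k)
    where
    go : ∀ {k} → Acc Fin._<_ k → k ≢ i → ¬ i ≤P k → InU w k ⇔ InU w′ k
    go {k} (acc rec) k≢i i≰k with J i ≤? M k
    ... | no J≰M = mk⇔ (λ u → contradiction (U-independent (GaloisArrow⇒> i→k) u (w′ , g)) J≰M)
                       (λ u′ → contradiction (≤-trans (γ⇒J≤z g) (InU⇒≤M u′)) J≰M)
      where
      i→k : GaloisArrow i k
      i→k = J≰M⇒GaloisArrow (k≢i ∘ sym) J≰M
    ... | yes J≤M = mk⇔
      (λ u → InU-transfer u (γ⇒z≤ g (InU⇒≤M u) J≤M) (λ a<k J≰ → from (lower a<k J≰)))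
      (λ u′ → InU-transfer u′ (≤-trans (⋖⇒≤ (γ⇒⋖ g)) (InU⇒≤M u′))
                                (λ a<k J≰ → to (lower a<k J≰)))
      where
      lower : ∀ {a} → a Fin.< k → J k ≰ M a → InU w a ⇔ InU w′ a
      lower {a} a<k J≰M = go (rec a<k) a≢i (λ i≤a → i≰k (k→a ◅ i≤a))
        where
        k→a : GaloisArrow k a
        k→a = J≰M⇒GaloisArrow (λ k≡a → Finₚ.<⇒≢ a<k (sym k≡a)) J≰M

        a≢i : a ≢ i
        a≢i refl = i≰k (k→a ◅ ε)

  InD-stable : ∀ {w w′ i} → γ w w′ i → ∀ {k} → k ≢ i → ¬ k ≤P i → InD w k ⇔ InD w′ k
  InD-stable {w} {w′} {i} g {k} = go (>-wellFounded k)
    where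
    go : ∀ {k} → Acc Fin._>_ k → k ≢ i → ¬ k ≤P i → InD w k ⇔ InD w′ k
    go {k} (acc rec) k≢i k≰i with J k ≤? M i
    ... | no J≰M = mk⇔ (λ d → contradiction (≤-trans (InD⇒J≤ d) (γ⇒y≤M g)) J≰M)
                       (λ d′ → contradiction (D-independent (GaloisArrow⇒> k→i) (w , g) d′) J≰M)
      where
      k→i : GaloisArrow k i
      k→i = J≰M⇒GaloisArrow k≢i J≰M
    ... | yes J≤M = mk⇔
      (λ d → InD-transfer d (≤-trans (InD⇒J≤ d) (⋖⇒≤ (γ⇒⋖ g)))
                            (λ k<b J≰ → from (upper k<b J≰)))
      (λ d′ → InD-transfer d′ (γ⇒≤y g (InD⇒J≤ d′) J≤M) (λ k<b J≰ → to (upper k<b J≰)))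
      where
      upper : ∀ {b} → k Fin.< b → J b ≰ M k → InD w b ⇔ InD w′ b
      upper {b} k<b J≰M = go (rec k<b) b≢i (λ b≤i → k≰i (b≤i ◅◅ (b→k ◅ ε)))
        where
        b→k : GaloisArrow b k
        b→k = J≰M⇒GaloisArrow (λ b≡k → Finₚ.<⇒≢ k<b (sym b≡k)) J≰M

        b≢i : b ≢ i
        b≢i refl = k≰i (b→k ◅ ε)

  -- Flips and rowmotion

  Flip-exists : ∀ i y → ∃[ y′ ] Flip i y y′
  Flip-exists i y with InD? y i
  ... | yes (x , g) = x , inj₁ g
  ... | no ¬d with InU? y i
  ...   | yes (z , g) = z , inj₂ (inj₁ (¬d , g))
  ...   | no ¬u = y , inj₂ (inj₂ (¬d , ¬u , refl))

  Flip⇒InU⇔InD : ∀ {y′} → Flip i y y′ → InU y′ i ⇔ InD y i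
  Flip⇒InU⇔InD (inj₁ g) = mk⇔ (λ _ → _ , g) (λ _ → _ , g)
  Flip⇒InU⇔InD (inj₂ (inj₁ (¬d , g))) = mk⇔ (⊥-elim ∘ InD⇒¬InU (_ , g)) (⊥-elim ∘ ¬d)
  Flip⇒InU⇔InD (inj₂ (inj₂ (¬d , ¬u , refl))) = mk⇔ (⊥-elim ∘ ¬u) (⊥-elim ∘ ¬d)

  Flip⇒InU-stable : ∀ {y′} → Flip i y y′ → k ≢ i → ¬ i ≤P k → InU y k ⇔ InU y′ k
  Flip⇒InU-stable (inj₁ g) k≢i i≰k = ⇔-sym (InU-stable g k≢i i≰k)
  Flip⇒InU-stable (inj₂ (inj₁ (_ , g))) k≢i i≰k = InU-stable g k≢i i≰k
  Flip⇒InU-stable (inj₂ (inj₂ (_ , _ , refl))) _ _ = ⇔-id _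

  Flip⇒InD-stable : ∀ {y′} → Flip i y y′ → k ≢ i → ¬ k ≤P i → InD y k ⇔ InD y′ k
  Flip⇒InD-stable (inj₁ g) k≢i k≰i = ⇔-sym (InD-stable g k≢i k≰i)
  Flip⇒InD-stable (inj₂ (inj₁ (_ , g))) k≢i k≰i = InD-stable g k≢i k≰i
  Flip⇒InD-stable (inj₂ (inj₂ (_ , _ , refl))) _ _ = ⇔-id _

  flip-sequence-exists : ∀ l x → ∃[ w ] IsFlipSequence l x w
  flip-sequence-exists l = ∃-run (Flip ∘ l) (Flip-exists ∘ l)

  module SlowMotion (l : Fin n → Fin n) (linear : IsLinearExtension l) (x : Carrier) where

    l-onto : ∀ k → ∃[ b ] l b ≡ k
    l-onto k = let b , onto = proj₁ (proj₂ linear) k in b , onto refl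

    Flipped : ℕ → Fin n → Set
    Flipped t k = ∃[ b ] toℕ b ℕ.< t × l b ≡ k

    Invariant : ℕ → Carrier → Set
    Invariant t y = (∀ k → Flipped t k → InU y k ⇔ InD x k)
                  × (∀ k → ¬ Flipped t k → InD y k ⇔ InD x k)

    invariant-start : Invariant 0 x
    invariant-start = (λ { _ (_ , () , _) }) , λ _ _ → ⇔-id _

    invariant-step : ∀ a {y y′} → Invariant (toℕ a) y → Flip (l a) y y′ → Invariant (suc (toℕ a)) y′
    invariant-step a {y} {y′} (flipped , pending) move = flipped′ , pending′
      where
      not-yet : ¬ Flipped (toℕ a) (l a)
      not-yet (b , b<a , lb≡la) = ℕₚ.<-irrefl (cong toℕ (proj₁ linear lb≡la)) b<a

      flipped′ : ∀ k → Flipped (suc (toℕ a)) k → InU y′ k ⇔ InD x k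
      flipped′ _ (b , b<1+a , refl) with ℕₚ.m<1+n⇒m<n∨m≡n b<1+a
      ... | inj₁ b<a = flipped (l b) (b , b<a , refl) ⇔-∘ ⇔-sym (Flip⇒InU-stable move lb≢la la≰lb)
        where
        lb≢la : l b ≢ l a
        lb≢la lb≡la = not-yet (b , b<a , lb≡la)

        la≰lb : ¬ l a ≤P l b
        la≰lb la≤lb = ℕₚ.<⇒≱ b<a (proj₂ (proj₂ linear) a b la≤lb)
      ... | inj₂ b≡a = subst (λ k → InU y′ k ⇔ InD x k) (cong l (sym (Finₚ.toℕ-injective b≡a)))
                             (pending (l a) not-yet ⇔-∘ Flip⇒InU⇔InD move)

      pending′ : ∀ k → ¬ Flipped (suc (toℕ a)) k → InD y′ k ⇔ InD x k
      pending′ k not-flipped =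
        pending k (not-flipped ∘ earlier) ⇔-∘ ⇔-sym (Flip⇒InD-stable move k≢la k≰la)
        where
        earlier : Flipped (toℕ a) k → Flipped (suc (toℕ a)) k
        earlier (b , b<a , lb≡k) = b , ℕₚ.m<n⇒m<1+n b<a , lb≡k

        k≢la : k ≢ l a
        k≢la refl = not-flipped (a , ℕₚ.n<1+n _ , refl)

        k≰la : ¬ k ≤P l a
        k≰la k≤la = let b , lb≡k = l-onto k in
          not-flipped (b , s≤s (proj₂ (proj₂ linear) b a (subst (_≤P l a) (sym lb≡k) k≤la)) , lb≡k)

    invariant-along : ∀ {w} → IsFlipSequence l x w → ∀ t → Invariant (toℕ t) (w t)
    invariant-along {w} (w₀≡x , steps) =
      <-weakInduction (λ t → Invariant (toℕ t) (w t)) (subst (Invariant 0) (sym w₀≡x) invariant-start) step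
      where
      step : ∀ a → Invariant (toℕ (inject₁ a)) (w (inject₁ a)) → Invariant (suc (toℕ a)) (w (Fin.suc a))
      step a inv =
        invariant-step a (subst (λ t → Invariant t (w (inject₁ a))) (Finₚ.toℕ-inject₁ a) inv) (steps a)

    slow-motion : ∀ w → IsFlipSequence l x w → Row x (w (fromℕ n))
    slow-motion w run k = let b , lb≡k = l-onto k in proj₁ final k (b , Finₚ.toℕ<n b , lb≡k)
      where
      final : Invariant n (w (fromℕ n))
      final =
        subst (λ t → Invariant t (w (fromℕ n))) (Finₚ.toℕ-fromℕ n) (invariant-along {w} run (fromℕ n))

  id-isLinearExtension : IsLinearExtension id
  id-isLinearExtension = id , (λ k → k , id) , λ _ _ → ≤P⇒≤

  row-exists : ∀ x → ∃[ y ] Row x y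
  row-exists x = let w , run = flip-sequence-exists id x in
    w (fromℕ n) , SlowMotion.slow-motion id id-isLinearExtension x w run

  row : Carrier → Carrier
  row x = proj₁ (row-exists x)

  row-injective : Injective _≡_ _≡_ row
  row-injective {x} {x′} row-x≡row-x′ = D-injective x x′ λ i →
    proj₂ (row-exists x′) i
      ⇔-∘ subst (λ y → InD x i ⇔ InU y i) row-x≡row-x′ (⇔-sym (proj₂ (row-exists x) i))

  row-onto : ∀ y → ∃[ x ] Row x y
  row-onto y = let x , row-x≡y = injective⇒onto row-injective y in
    x , subst (Row x) row-x≡y (proj₂ (row-exists x))

theorem1p3 : (L : FiniteLattice) (n : ℕ) (c : Fin (suc n) → FiniteLattice.Carrier L)
  → Notions.IsExtremal L n
  → Notions.IsLeftModularChain L n c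
  → let open Notions.Labelling L n c in
    ((∀ x y → (∀ i → InD x i ⇔ InD y i) → x ≡ y)
     × (∀ x y → (∀ i → InU x i ⇔ InU y i) → x ≡ y)
     × (∀ x → ∃[ y ] (∀ i → InD x i ⇔ InU y i))
     × (∀ y → ∃[ x ] (∀ i → InU y i ⇔ InD x i)))
    × (∀ (l : Fin n → Fin n) → IsLinearExtension l → ∀ x
       → (∃[ w ] IsFlipSequence l x w)
       × (∀ w → IsFlipSequence l x w → Row x (w (fromℕ n))))
theorem1p3 L n c extremal chain =
  ( D-injective
  , U-injective
  , (λ x → let y , y-is-row-x = row-exists x in y , ⇔-sym ∘ y-is-row-x)
  , row-onto )
  , λ l linear x → flip-sequence-exists l x , SlowMotion.slow-motion l linear x
  where open TrimFacts L n c extremal chain
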